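{- Let $\mathcal{A}_1,\mathcal{A}_2,\dots$ be an exponential sequence of arrangements. Let $B=\{B_1,\dots,B_m\}$ be a set partition of $\{1,\dots,n\}$ and $F=\{x\in\mathbb{R}^n: x_i=x_j \text{ whenever } i,j \text{ lie in the same block of } B\}$ the corresponding flat of $\underline{\mathcal{A}_n}$. Then $\mathcal{L}((\mathcal{A}_n)_F)\cong\prod_{i=1}^m\mathcal{L}(\mathcal{A}_{|B_i|})$.
   Context: $\operatorname{Braid}(n)=\{\{x_i-x_j=0\}:1\le i<j\le n\}$ in $\mathbb{R}^n$. For a hyperplane $H=\{w\cdot x=a\}$, $\underline{H}=\{w\cdot x=0\}$, and $\underline{\mathcal{A}}=\{\underline{H}:H\in\mathcal{A}\}$. $\mathcal{L}(\mathcal{B})$ is the poset of nonempty intersections of subsets of hyperplanes of $\mathcal{B}$, ordered by reverse inclusion. Localization at a linear subspace $V$: $\mathcal{A}_V=\{H\in\mathcal{A}:V\subseteq H\text{ or }V\cap H=\emptyset\}$. An exponential sequence of arrangements is a sequence $\mathcal{A}_1,\mathcal{A}_2,\dots$ with $\mathcal{A}_n$ an arrangement in $\mathbb{R}^n$ such that (1) $\underline{\mathcal{A}_n}=\operatorname{Braid}(n)$ (every hyperplane of $\mathcal{A}_n$ is parallel to some $x_i-x_j=0$, and each such hyperplane has a parallel hyperplane in $\mathcal{A}_n$), and (2) for every $S\subseteq\{1,\dots,n\}$, with $V_S=\{x:x_i=x_j\ \forall i,j\in S\}$, we have $\mathcal{L}((\mathcal{A}_n)_{V_S})\cong\mathcal{L}(\mathcal{A}_{|S|})$.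 -}

module Defs where

open import Data.Nat using (ℕ; zero; suc)
open import Data.Fin using (Fin; zero; suc; _<_; _≟_)
open import Data.Fin.Subset using (Subset; _∈_) renaming (∣_∣ to ∣_∣ˢ)
open import Data.List using (List; []; _∷_; length; filter)
open import Data.List.Relation.Unary.All using (All)
import Data.List.Membership.Propositional as LM
open import Data.List.Base using ()
open import Data.Product using (Σ; ∃; _×_; _,_)
open import Data.Sum using (_⊎_)
open import Data.Empty using (⊥)
open import Relation.Nullary using (¬_)
open import Relation.Binary.PropositionalEquality using (_≡_; _≢_)
open import Algebra.Structures using (IsCommutativeRing)
open import Relation.Binary.Structures using (IsStrictTotalOrder)
open import Function using (_∘_)
open import Data.List using (allFin)

-- The real numbers, axiomatised as a complete ordered field
-- (the theorem is quantified over every such structure, i.e. over ℝ).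

record RealField : Set₁ where
  infixl 6 _+_
  infixl 7 _*_
  field
    Carrier : Set
    _+_ _*_ : Carrier → Carrier → Carrier
    -_      : Carrier → Carrier
    0# 1#   : Carrier
    _<ℝ_    : Carrier → Carrier → Set
    isCommutativeRing : IsCommutativeRing _≡_ _+_ _*_ -_ 0# 1#
    0≢1     : 0# ≢ 1#
    inverse : ∀ x → x ≢ 0# → Σ Carrier λ y → x * y ≡ 1#
    isStrictTotalOrder : IsStrictTotalOrder _≡_ _<ℝ_
    +-mono-< : ∀ x y z → x <ℝ y → (x + z) <ℝ (y + z)
    *-pos    : ∀ x y → 0# <ℝ x → 0# <ℝ y → 0# <ℝ (x * y)
    sup : ∀ (P : Carrier → Set) → Σ Carrier P →
          (Σ Carrier λ u → ∀ x → P x → ¬ (u <ℝ x)) →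
          Σ Carrier λ s → (∀ x → P x → ¬ (s <ℝ x)) ×
                          (∀ u → (∀ x → P x → ¬ (u <ℝ x)) → ¬ (u <ℝ s))

module _ (ℝ : RealField) where
  open RealField ℝ

  Pt : ℕ → Set
  Pt n = Fin n → Carrier

  PtSet : ℕ → Set₁
  PtSet n = Pt n → Set

  sumF : ∀ n → (Fin n → Carrier) → Carrier
  sumF zero    f = 0#
  sumF (suc n) f = f zero + sumF n (f ∘ suc)

  dot : ∀ {n} → Pt n → Pt n → Carrier
  dot {n} w x = sumF n (λ k → w k * x k)

  record Hyperplane (n : ℕ) : Set where
    constructor hyp
    field
      normal  : Pt n
      offset  : Carrier
      nonzero : Σ (Fin n) λ k → normal k ≢ 0#

  ⟦_⟧ : ∀ {n} → Hyperplane n → PtSet n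
  ⟦ hyp w a _ ⟧ x = dot w x ≡ a

  ⟦_⟧₀ : ∀ {n} → Hyperplane n → PtSet n
  ⟦ hyp w a _ ⟧₀ x = dot w x ≡ 0#

  braid : ∀ {n} → Fin n → Fin n → PtSet n
  braid i j x = x i ≡ x j

  _⊆ₚ_ : ∀ {n} → PtSet n → PtSet n → Set
  X ⊆ₚ Y = ∀ x → X x → Y x

  _≐_ : ∀ {n} → PtSet n → PtSet n → Set
  X ≐ Y = (X ⊆ₚ Y) × (Y ⊆ₚ X)

  ⋂ : ∀ {n} → List (Hyperplane n) → PtSet n
  ⋂ S x = All (λ H → ⟦ H ⟧ x) S

  -- An arrangement is a finite set (list) of hyperplanes. Sub-arrangements
  -- (such as localizations) are described by a membership predicate.
  Arrangement : ℕ → Set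
  Arrangement n = List (Hyperplane n)

  Members : ℕ → Set₁
  Members n = Hyperplane n → Set

  mem : ∀ {n} → Arrangement n → Members n
  mem A H = H LM.∈ A

  loc : ∀ {n} → Arrangement n → PtSet n → Members n
  loc A V H = (H LM.∈ A) × ((V ⊆ₚ ⟦ H ⟧) ⊎ (∀ x → V x → ⟦ H ⟧ x → ⊥))

-- Preorders (posets presented with extensional equality = ≤ both ways)

record Pre : Set₁ where
  field
    Elt : Set
    _≤_ : Elt → Elt → Set

open Pre

_≅_ : Pre → Pre → Set
P ≅ Q = Σ (Elt P → Elt Q) λ f →
          (∀ x y → (_≤_ P x y → _≤_ Q (f x) (f y)) × (_≤_ Q (f x) (f y) → _≤_ P x y)) ×
          (∀ y → Σ (Elt P) λ x → _≤_ Q (f x) y × _≤_ Q y (f x))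

Π : (m : ℕ) → (Fin m → Pre) → Pre
Π m P = record { Elt = (i : Fin m) → Elt (P i)
               ; _≤_ = λ x y → ∀ i → _≤_ (P i) (x i) (y i) }

module _ (ℝ : RealField) where

  L : ∀ {n} → Members ℝ n → Pre
  L {n} P = record
    { Elt = Σ (List (Hyperplane ℝ n)) λ S → All P S × Σ (Pt ℝ n) (⋂ ℝ S)
    ; _≤_ = λ X Y → _⊆ₚ_ ℝ (⋂ ℝ (Data.Product.proj₁ Y)) (⋂ ℝ (Data.Product.proj₁ X)) }

  V : ∀ {n} → Subset n → PtSet ℝ n
  V S x = ∀ i j → i ∈ S → j ∈ S → x i ≡ x j

  record Exponential (A : (n : ℕ) → Arrangement ℝ n) : Set₁ where
    field
      under⊆braid : ∀ n H → H LM.∈ A n →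
        Σ (Fin n) λ i → Σ (Fin n) λ j → i < j × _≐_ ℝ (⟦_⟧₀ ℝ H) (braid ℝ i j)
      braid⊆under : ∀ n (i j : Fin n) → i < j →
        Σ (Hyperplane ℝ n) λ H → H LM.∈ A n × _≐_ ℝ (⟦_⟧₀ ℝ H) (braid ℝ i j)
      restrict : ∀ n (S : Subset n) →
        L (loc ℝ (A n) (V S)) ≅ L (mem ℝ (A ∣ S ∣ˢ))

  -- flat of a set partition given by a block labelling b : [n] → [m]
  flat : ∀ {n m} → (Fin n → Fin m) → PtSet ℝ n
  flat b x = ∀ i j → b i ≡ b j → x i ≡ x j

blockSize : ∀ {n m} → (Fin n → Fin m) → Fin m → ℕ
blockSize {n} b i = length (filter (λ k → b k ≟ i) (allFin n))

-- b labels a set partition into exactly m (nonempty) blocks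
Surj : ∀ {n m} → (Fin n → Fin m) → Set
Surj {n} {m} b = ∀ (i : Fin m) → Σ (Fin n) λ k → b k ≡ i

{-# OPTIONS --safe #-}
-- Every hyperplane of 𝒜ₙ is parallel to some x_i = x_j, and it survives localization at the
-- flat F only if i and j lie in one block B_k: otherwise a line inside F crosses it
-- transversally. Membership in such a hyperplane depends only on the coordinates in B_k, so
-- (𝒜ₙ)_F is the disjoint union of the localizations at V_{B_k}, and an intersection of
-- hyperplanes of (𝒜ₙ)_F is the product of its block-wise parts. Splicing points block by block
-- shows that inclusion of nonempty such products is block-wise inclusion, whence
-- L((𝒜ₙ)_F) ≅ ∏ₖ L((𝒜ₙ)_{V_{B_k}}); each factor is L(𝒜_{|B_k|}) by the exponential property.
module Submission where

open import Defs
open import Data.Nat using (ℕ; zero; suc)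
open import Data.Bool using (true; false; if_then_else_)
open import Data.Fin using (Fin; zero; suc; _≟_)
open import Data.Fin.Properties using (<⇒≢)
open import Data.Fin.Subset using (Subset) renaming (∣_∣ to ∣_∣ˢ; _∈_ to _∈ˢ_)
open import Data.List using (List; []; _∷_; length; filter; concat)
import Data.List as List
open import Data.List.Relation.Unary.All as All using (All; []; _∷_)
open import Data.List.Relation.Unary.All.Properties using (all-filter; filter⁺)
open import Data.List.Membership.Propositional using (_∈_)
open import Data.List.Membership.Propositional.Properties
  using (∈-filter⁺; ∈-filter⁻; ∈-concat⁺′; ∈-concat⁻′; ∈-tabulate⁺; ∈-tabulate⁻)
import Data.Vec as Vec
open import Data.Vec.Properties using ([]=⇒lookup; lookup⇒[]=; lookup∘tabulate)
open import Data.Product using (Σ; ∃; ∃₂; _×_; _,_; proj₁; proj₂)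
open import Data.Sum using (_⊎_; inj₁; inj₂)
open import Data.Empty using (⊥)
open import Function using (_∘_; id)
open import Relation.Nullary using (¬_; does; yes; no; contradiction)
open import Relation.Nullary.Decidable using (dec-true; dec-false)
open import Relation.Unary using (Pred; Decidable)
open import Relation.Binary.Structures using (IsStrictTotalOrder)
open import Relation.Binary.PropositionalEquality
open import Algebra.Bundles using (CommutativeRing)

open Pre

OrderEmbedding : (P Q : Pre) → (Elt P → Elt Q) → Set
OrderEmbedding P Q f =
  ∀ x y → (_≤_ P x y → _≤_ Q (f x) (f y)) × (_≤_ Q (f x) (f y) → _≤_ P x y)

EssentiallySurjective : (P Q : Pre) → (Elt P → Elt Q) → Set
EssentiallySurjective P Q f = ∀ y → Σ (Elt P) λ x → _≤_ Q (f x) y × _≤_ Q y (f x)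

embedding : ∀ {P Q} (φ : P ≅ Q) → OrderEmbedding P Q (proj₁ φ)
embedding = proj₁ ∘ proj₂

surjective : ∀ {P Q} (φ : P ≅ Q) → EssentiallySurjective P Q (proj₁ φ)
surjective = proj₂ ∘ proj₂

-- Unlike Relation.Binary's Transitive the points are explicit arguments: the orders of the posets L
-- are not injective, so hidden ones could not be inferred.
Transitiveᴾ : Pre → Set
Transitiveᴾ P = ∀ x y z → _≤_ P x y → _≤_ P y z → _≤_ P x z

≅-trans : ∀ {P Q R} → Transitiveᴾ R → P ≅ Q → Q ≅ R → P ≅ R
≅-trans {P} {Q} {R} ≤-trans (f , f-emb , f-surj) (g , g-emb , g-surj) = g ∘ f , emb , surj
  where
  emb : OrderEmbedding P R (g ∘ f)
  emb x y = proj₁ (g-emb (f x) (f y)) ∘ proj₁ (f-emb x y)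
          , proj₂ (f-emb x y) ∘ proj₂ (g-emb (f x) (f y))

  surj : EssentiallySurjective P R (g ∘ f)
  surj z =
    let y , gy≤z , z≤gy = g-surj z
        x , fx≤y , y≤fx = f-surj y
    in x , ≤-trans _ _ _ (proj₁ (g-emb _ _) fx≤y) gy≤z , ≤-trans _ _ _ z≤gy (proj₁ (g-emb _ _) y≤fx)

Π-trans : ∀ {m} {P : Fin m → Pre} → (∀ k → Transitiveᴾ (P k)) → Transitiveᴾ (Π m P)
Π-trans ≤-trans x y z x≤y y≤z k = ≤-trans k (x k) (y k) (z k) (x≤y k) (y≤z k)

Π-cong : ∀ {m} {P Q : Fin m → Pre} → (∀ k → P k ≅ Q k) → Π m P ≅ Π m Q
Π-cong {m} {P} {Q} φ = f , emb , surj
  where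
  f : Elt (Π m P) → Elt (Π m Q)
  f x k = proj₁ (φ k) (x k)

  emb : OrderEmbedding (Π m P) (Π m Q) f
  emb x y = (λ x≤y k → proj₁ (embedding {P k} {Q k} (φ k) (x k) (y k)) (x≤y k))
          , (λ fx≤fy k → proj₂ (embedding {P k} {Q k} (φ k) (x k) (y k)) (fx≤fy k))

  surj : EssentiallySurjective (Π m P) (Π m Q) f
  surj y = (λ k → proj₁ (surjective {P k} {Q k} (φ k) (y k)))
         , (λ k → proj₁ (proj₂ (surjective {P k} {Q k} (φ k) (y k))))
         , (λ k → proj₂ (proj₂ (surjective {P k} {Q k} (φ k) (y k))))

L-trans : ∀ {ℝ n} {P : Members ℝ n} → Transitiveᴾ (L ℝ P)
L-trans _ _ _ X≤Y Y≤Z x Zx = X≤Y x (Y≤Z x Zx)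

L-cong : ∀ {ℝ n} {P Q : Members ℝ n} → (∀ {H} → P H → Q H) → (∀ {H} → Q H → P H) →
         L ℝ P ≅ L ℝ Q
L-cong P⇒Q Q⇒P = (λ (S , ps , x) → S , All.map P⇒Q ps , x)
               , (λ _ _ → id , id)
               , (λ (S , qs , x) → (S , All.map Q⇒P qs , x) , (λ _ → id) , (λ _ → id))

module _ {n p} {P : Pred (Fin n) p} (P? : Decidable P) where

  ∈-tabulate-does⁺ : ∀ {l} → P l → l ∈ˢ Vec.tabulate (does ∘ P?)
  ∈-tabulate-does⁺ {l} Pl = lookup⇒[]= l _ (trans (lookup∘tabulate _ l) (dec-true (P? l) Pl))

  ∈-tabulate-does⁻ : ∀ {l} → l ∈ˢ Vec.tabulate (does ∘ P?) → P l
  ∈-tabulate-does⁻ {l} l∈ with P? l | trans (sym (lookup∘tabulate _ l)) ([]=⇒lookup l∈)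
  ... | yes Pl | _  = Pl
  ... | no _   | ()

∣tabulate∣≡length-filter : ∀ {a p} {A : Set a} {P : Pred A p} (P? : Decidable P)
                           {n} (g : Fin n → A) →
  ∣ Vec.tabulate (does ∘ P? ∘ g) ∣ˢ ≡ length (filter P? (List.tabulate g))
∣tabulate∣≡length-filter P? {zero}  g = refl
∣tabulate∣≡length-filter P? {suc n} g with does (P? (g zero))
... | true  = cong suc (∣tabulate∣≡length-filter P? (g ∘ suc))
... | false = ∣tabulate∣≡length-filter P? (g ∘ suc)

module Geometry (ℝ : RealField) where
  open RealField ℝ
  open IsStrictTotalOrder isStrictTotalOrder using () renaming (_≟_ to _≟ℝ_)

  private
    commutativeRing : CommutativeRing _ _
    commutativeRing = record { isCommutativeRing = isCommutativeRing }

  open CommutativeRing commutativeRing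
    using (zeroˡ; zeroʳ; distribˡ; *-assoc; *-comm; *-identityˡ; *-identityʳ;
           +-identityˡ; +-identityʳ; *-commutativeSemigroup)
  open import Algebra.Properties.CommutativeSemigroup *-commutativeSemigroup using (x∙yz≈y∙xz)
  open ≡-Reasoning

  1≢0 : 1# ≢ 0#
  1≢0 = 0≢1 ∘ sym

  infixr 7 _∙_
  _∙_ : ∀ {n} → Carrier → Pt ℝ n → Pt ℝ n
  (t ∙ d) l = t * d l

  χ : ∀ {n p} → (Fin n → Fin p) → Fin p → Pt ℝ n
  χ f a l = if does (f l ≟ a) then 1# else 0#

  χ-≡ : ∀ {n p} (f : Fin n → Fin p) {a} l → f l ≡ a → χ f a l ≡ 1#
  χ-≡ f {a} l fl≡a = cong (λ β → if β then 1# else 0#) (dec-true (f l ≟ a) fl≡a)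

  χ-≢ : ∀ {n p} (f : Fin n → Fin p) {a} l → f l ≢ a → χ f a l ≡ 0#
  χ-≢ f {a} l fl≢a = cong (λ β → if β then 1# else 0#) (dec-false (f l ≟ a) fl≢a)

  sumF-cong : ∀ n {f g : Fin n → Carrier} → (∀ l → f l ≡ g l) → sumF ℝ n f ≡ sumF ℝ n g
  sumF-cong zero    f≗g = refl
  sumF-cong (suc n) f≗g = cong₂ _+_ (f≗g zero) (sumF-cong n (f≗g ∘ suc))

  dot-zero : ∀ {n} (w : Pt ℝ n) → dot ℝ w (λ _ → 0#) ≡ 0#
  dot-zero {zero}  w = refl
  dot-zero {suc n} w = trans (cong₂ _+_ (zeroʳ (w zero)) (dot-zero (w ∘ suc))) (+-identityˡ 0#)

  dot-unit : ∀ {n} (w : Pt ℝ n) l → dot ℝ w (χ id l) ≡ w l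
  dot-unit {suc n} w zero =
    trans (cong₂ _+_ (*-identityʳ (w zero)) (dot-zero (w ∘ suc))) (+-identityʳ (w zero))
  dot-unit {suc n} w (suc l) =
    trans (cong₂ _+_ (zeroʳ (w zero)) (dot-unit (w ∘ suc) l)) (+-identityˡ (w (suc l)))

  dot-scale : ∀ {n} (w d : Pt ℝ n) t → dot ℝ w (t ∙ d) ≡ t * dot ℝ w d
  dot-scale {zero}  w d t = sym (zeroʳ t)
  dot-scale {suc n} w d t = begin
    w zero * (t * d zero) + dot ℝ (w ∘ suc) (t ∙ d ∘ suc)
      ≡⟨ cong₂ _+_ (x∙yz≈y∙xz (w zero) t (d zero)) (dot-scale (w ∘ suc) (d ∘ suc) t) ⟩
    t * (w zero * d zero) + t * dot ℝ (w ∘ suc) (d ∘ suc)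
      ≡⟨ distribˡ t _ _ ⟨
    t * dot ℝ w d ∎

  dot-cong-support : ∀ {n} (w : Pt ℝ n) {x y : Pt ℝ n} →
                     (∀ l → w l ≢ 0# → x l ≡ y l) → dot ℝ w x ≡ dot ℝ w y
  dot-cong-support {n} w {x} {y} agree = sumF-cong n term
    where
    term : ∀ l → w l * x l ≡ w l * y l
    term l with w l ≟ℝ 0#
    ... | yes wl≡0 rewrite wl≡0 = trans (zeroˡ (x l)) (sym (zeroˡ (y l)))
    ... | no wl≢0 = cong (w l *_) (agree l wl≢0)

  ⟦⟧-support : ∀ {n} (H : Hyperplane ℝ n) {x y : Pt ℝ n} →
               (∀ l → Hyperplane.normal H l ≢ 0# → x l ≡ y l) → ⟦_⟧ ℝ H x → ⟦_⟧ ℝ H y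
  ⟦⟧-support (hyp w a _) agree Hx = trans (sym (dot-cong-support w agree)) Hx

  braid-normal-support : ∀ {n} (H : Hyperplane ℝ n) {i j l} →
    _≐_ ℝ (⟦_⟧₀ ℝ H) (braid ℝ i j) → Hyperplane.normal H l ≢ 0# → l ≡ i ⊎ l ≡ j
  braid-normal-support (hyp w a _) {i} {j} {l} H∥ij wl≢0 with l ≟ i | l ≟ j
  ... | yes l≡i | _       = inj₁ l≡i
  ... | no _    | yes l≡j = inj₂ l≡j
  ... | no l≢i  | no l≢j  = contradiction wl≡0 wl≢0
    where
    eₗ∈braid : braid ℝ i j (χ id l)
    eₗ∈braid = trans (χ-≢ id i (l≢i ∘ sym)) (sym (χ-≢ id j (l≢j ∘ sym)))
    wl≡0 : w l ≡ 0#
    wl≡0 = trans (sym (dot-unit w l)) (proj₂ H∥ij (χ id l) eₗ∈braid)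

  Localizes : ∀ {n} → PtSet ℝ n → Hyperplane ℝ n → Set
  Localizes X H = _⊆ₚ_ ℝ X (⟦_⟧ ℝ H) ⊎ (∀ x → X x → ⟦_⟧ ℝ H x → ⊥)

  Localizes-antitone : ∀ {n} {X Y : PtSet ℝ n} {H} → _⊆ₚ_ ℝ X Y → Localizes Y H → Localizes X H
  Localizes-antitone X⊆Y (inj₁ Y⊆H)   = inj₁ λ x Xx → Y⊆H x (X⊆Y x Xx)
  Localizes-antitone X⊆Y (inj₂ Y∩H=∅) = inj₂ λ x Xx → Y∩H=∅ x (X⊆Y x Xx)

  transversal-line⇒¬Localizes : ∀ {n} {X : PtSet ℝ n} (H : Hyperplane ℝ n) {d : Pt ℝ n} →
    ¬ ⟦_⟧₀ ℝ H d → (∀ t → X (t ∙ d)) → ¬ Localizes X H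
  transversal-line⇒¬Localizes (hyp w a _) {d} d∉H line (inj₁ X⊆H) = d∉H (begin
    dot ℝ w d             ≡⟨ *-identityˡ _ ⟨
    1# * dot ℝ w d        ≡⟨ dot-scale w d 1# ⟨
    dot ℝ w (1# ∙ d)      ≡⟨ X⊆H _ (line 1#) ⟩
    a                     ≡⟨ X⊆H _ (line 0#) ⟨
    dot ℝ w (0# ∙ d)      ≡⟨ dot-scale w d 0# ⟩
    0# * dot ℝ w d        ≡⟨ zeroˡ _ ⟩
    0#                    ∎)
  transversal-line⇒¬Localizes (hyp w a _) {d} d∉H line (inj₂ X∩H=∅) =
    X∩H=∅ _ (line (a * c⁻¹)) (begin
      dot ℝ w ((a * c⁻¹) ∙ d) ≡⟨ dot-scale w d (a * c⁻¹) ⟩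
      a * c⁻¹ * c            ≡⟨ *-assoc a c⁻¹ c ⟩
      a * (c⁻¹ * c)          ≡⟨ cong (a *_) (trans (*-comm c⁻¹ c) cc⁻¹≡1) ⟩
      a * 1#                 ≡⟨ *-identityʳ a ⟩
      a                      ∎)
    where
    c = dot ℝ w d
    c⁻¹ = proj₁ (inverse c d∉H)
    cc⁻¹≡1 = proj₂ (inverse c d∉H)

  separating-line⇒¬Localizes : ∀ {n p} {X : PtSet ℝ n} (H : Hyperplane ℝ n) {i j}
    {f : Fin n → Fin p} {a} → _≐_ ℝ (⟦_⟧₀ ℝ H) (braid ℝ i j) → f i ≡ a → f j ≢ a →
    (∀ t → X (t ∙ χ f a)) → ¬ Localizes X H
  separating-line⇒¬Localizes H {i} {j} {f} H∥ij fi≡a fj≢a =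
    transversal-line⇒¬Localizes H λ χ∈H →
      1≢0 (trans (sym (χ-≡ f i fi≡a)) (trans (proj₁ H∥ij _ χ∈H) (χ-≢ f j fj≢a)))

module Blocks (ℝ : RealField) {n m : ℕ} (c : Fin n → Fin m) where
  open RealField ℝ using (0#)
  open Geometry ℝ using (⟦⟧-support)

  Agree : Fin m → Pt ℝ n → Pt ℝ n → Set
  Agree k x y = ∀ l → c l ≡ k → x l ≡ y l

  Agree-sym : ∀ {k x y} → Agree k x y → Agree k y x
  Agree-sym x≈y l cl≡k = sym (x≈y l cl≡k)

  BlockLocal : Fin m → PtSet ℝ n → Set
  BlockLocal k X = ∀ {x y} → Agree k x y → X x → X y

  splice : Fin m → Pt ℝ n → Pt ℝ n → Pt ℝ n
  splice k x y l = if does (c l ≟ k) then x l else y l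

  splice-agree : ∀ {k} x y → Agree k x (splice k x y)
  splice-agree {k} x y l cl≡k =
    sym (cong (λ β → if β then x l else y l) (dec-true (c l ≟ k) cl≡k))

  splice-agree-elsewhere : ∀ {j k} x y → j ≢ k → Agree j y (splice k x y)
  splice-agree-elsewhere {j} {k} x y j≢k l cl≡j =
    sym (cong (λ β → if β then x l else y l) (dec-false (c l ≟ k) (j≢k ∘ trans (sym cl≡j))))

  blockwise-⊆ : (C D : Fin m → PtSet ℝ n) →
    (∀ k → BlockLocal k (C k)) → (∀ k → BlockLocal k (D k)) → ∀ {y} → (∀ k → D k y) →
    (∀ z → (∀ k → D k z) → ∀ k → C k z) → ∀ k → _⊆ₚ_ ℝ (D k) (C k)
  blockwise-⊆ C D C-local D-local {y} Dy ⋂D⊆⋂C k x Dₖx =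
    C-local k (Agree-sym (splice-agree x y)) (⋂D⊆⋂C (splice k x y) D-splice k)
    where
    D-splice : ∀ j → D j (splice k x y)
    D-splice j with j ≟ k
    ... | yes refl = D-local j (splice-agree x y) Dₖx
    ... | no j≢k   = D-local j (splice-agree-elsewhere x y j≢k) (Dy j)

  InBlock : Fin m → Hyperplane ℝ n → Set
  InBlock k H = ∀ l → Hyperplane.normal H l ≢ 0# → c l ≡ k

  InBlock⇒BlockLocal : ∀ {k H} → InBlock k H → BlockLocal k (⟦_⟧ ℝ H)
  InBlock⇒BlockLocal {H = H} H⊆k x≈y = ⟦⟧-support H λ l wl≢0 → x≈y l (H⊆k l wl≢0)

  ⋂-BlockLocal : ∀ {k S} → All (InBlock k) S → BlockLocal k (⋂ ℝ S)
  ⋂-BlockLocal []                      x≈y []        = []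
  ⋂-BlockLocal {S = H ∷ _} (H⊆k ∷ S⊆k) x≈y (Hx ∷ Sx) =
    InBlock⇒BlockLocal {H = H} H⊆k x≈y Hx ∷ ⋂-BlockLocal S⊆k x≈y Sx

  -- Only meaningful when the normal of H is supported in a single block.
  block : Hyperplane ℝ n → Fin m
  block H = c (proj₁ (Hyperplane.nonzero H))

  module _ (P : Members ℝ n) (P-inBlock : ∀ {H} → P H → InBlock (block H) H) where

    BlockPart : Fin m → Members ℝ n
    BlockPart k H = P H × block H ≡ k

    BlockPart⇒InBlock : ∀ {k H} → BlockPart k H → InBlock k H
    BlockPart⇒InBlock (pH , refl) = P-inBlock pH

    part : Fin m → List (Hyperplane ℝ n) → List (Hyperplane ℝ n)
    part k = filter (λ H → block H ≟ k)

    All-part : ∀ {k S} → All P S → All (BlockPart k) (part k S)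
    All-part {k} {S} ps = All.zip (filter⁺ _ ps , all-filter _ S)

    part-BlockLocal : ∀ {k S} → All P S → BlockLocal k (⋂ ℝ (part k S))
    part-BlockLocal = ⋂-BlockLocal ∘ All.map BlockPart⇒InBlock ∘ All-part

    ⋂-part : ∀ {k S x} → ⋂ ℝ S x → ⋂ ℝ (part k S) x
    ⋂-part = filter⁺ _

    ⋂-parts : ∀ {S x} → (∀ k → ⋂ ℝ (part k S) x) → ⋂ ℝ S x
    ⋂-parts Sₖx = All.tabulate λ {H} H∈S → All.lookup (Sₖx (block H)) (∈-filter⁺ _ H∈S refl)

    ΠL-BlockPart : Pre
    ΠL-BlockPart = Π m (λ k → L ℝ (BlockPart k))

    blockParts : Elt (L ℝ P) → Elt ΠL-BlockPart
    blockParts (S , ps , x , Sx) k = part k S , All-part ps , x , ⋂-part Sx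

    blockParts-embedding : OrderEmbedding (L ℝ P) ΠL-BlockPart blockParts
    blockParts-embedding (S , ps , _) (T , qs , y , Ty) =
      (λ T⊆S → blockwise-⊆ (λ k → ⋂ ℝ (part k S)) (λ k → ⋂ ℝ (part k T))
                 (λ _ → part-BlockLocal ps) (λ _ → part-BlockLocal qs) (λ _ → ⋂-part Ty)
                 (λ z Tₖz k → ⋂-part (T⊆S z (⋂-parts Tₖz))))
      , (λ Tₖ⊆Sₖ x Tx → ⋂-parts λ k → Tₖ⊆Sₖ k x (⋂-part Tx))

    module Preimage (Y : Elt ΠL-BlockPart) where
      T : Fin m → List (Hyperplane ℝ n)
      T k = proj₁ (Y k)

      Tₖ⊆k : ∀ k → All (BlockPart k) (T k)
      Tₖ⊆k k = proj₁ (proj₂ (Y k))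

      y : Fin m → Pt ℝ n
      y k = proj₁ (proj₂ (proj₂ (Y k)))

      S : List (Hyperplane ℝ n)
      S = concat (List.tabulate T)

      ∈S⁺ : ∀ {k H} → H ∈ T k → H ∈ S
      ∈S⁺ {k} H∈Tₖ = ∈-concat⁺′ H∈Tₖ (∈-tabulate⁺ k)

      ∈S⁻ : ∀ {H} → H ∈ S → ∃ λ k → H ∈ T k
      ∈S⁻ H∈S =
        let _ , H∈xs , xs∈ = ∈-concat⁻′ (List.tabulate T) H∈S
            k , xs≡Tₖ = ∈-tabulate⁻ xs∈
        in k , subst (_ ∈_) xs≡Tₖ H∈xs

      z : Pt ℝ n
      z l = y (c l) l

      Tₖz : ∀ k → ⋂ ℝ (T k) z
      Tₖz k = ⋂-BlockLocal (All.map BlockPart⇒InBlock (Tₖ⊆k k))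
                (λ l cl≡k → cong (λ j → y j l) (sym cl≡k)) (proj₂ (proj₂ (proj₂ (Y k))))

      X : Elt (L ℝ P)
      X = S
        , All.tabulate (λ H∈S → let k , H∈Tₖ = ∈S⁻ H∈S in proj₁ (All.lookup (Tₖ⊆k k) H∈Tₖ))
        , z
        , All.tabulate (λ H∈S → let k , H∈Tₖ = ∈S⁻ H∈S in All.lookup (Tₖz k) H∈Tₖ)

      ⋂Tₖ⊆⋂partₖS : ∀ k → _⊆ₚ_ ℝ (⋂ ℝ (T k)) (⋂ ℝ (part k S))
      ⋂Tₖ⊆⋂partₖS k x Tₖx = All.tabulate λ H∈Sₖ →
        let H∈S , blockH≡k = ∈-filter⁻ _ H∈Sₖ
            j , H∈Tⱼ = ∈S⁻ H∈S
            j≡k = trans (sym (proj₂ (All.lookup (Tₖ⊆k j) H∈Tⱼ))) blockH≡k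
        in All.lookup Tₖx (subst (λ j → _ ∈ T j) j≡k H∈Tⱼ)

      ⋂partₖS⊆⋂Tₖ : ∀ k → _⊆ₚ_ ℝ (⋂ ℝ (part k S)) (⋂ ℝ (T k))
      ⋂partₖS⊆⋂Tₖ k x Sₖx = All.tabulate λ H∈Tₖ →
        All.lookup Sₖx (∈-filter⁺ _ (∈S⁺ H∈Tₖ) (proj₂ (All.lookup (Tₖ⊆k k) H∈Tₖ)))

    L-blocks : L ℝ P ≅ ΠL-BlockPart
    L-blocks = blockParts , blockParts-embedding ,
               λ Y → let open Preimage Y in X , ⋂Tₖ⊆⋂partₖS , ⋂partₖS⊆⋂Tₖ

module Localization (ℝ : RealField) (A : (n : ℕ) → Arrangement ℝ n) (E : Exponential ℝ A)
                    {n m : ℕ} (b : Fin n → Fin m) where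
  open RealField ℝ using (_*_; 0#; 1#)
  open Exponential E
  open Geometry ℝ
  open Blocks ℝ b

  blockSubset : Fin m → Subset n
  blockSubset k = Vec.tabulate (does ∘ λ l → b l ≟ k)

  ∣blockSubset∣ : ∀ k → ∣ blockSubset k ∣ˢ ≡ blockSize b k
  ∣blockSubset∣ k = ∣tabulate∣≡length-filter (λ l → b l ≟ k) id

  ∈blockSubset⁺ : ∀ {k l} → b l ≡ k → l ∈ˢ blockSubset k
  ∈blockSubset⁺ {k} = ∈-tabulate-does⁺ (λ l → b l ≟ k)

  ∈blockSubset⁻ : ∀ {k l} → l ∈ˢ blockSubset k → b l ≡ k
  ∈blockSubset⁻ {k} = ∈-tabulate-does⁻ (λ l → b l ≟ k)

  flat⊆V : ∀ k → _⊆ₚ_ ℝ (flat ℝ b) (V ℝ (blockSubset k))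
  flat⊆V k x Fx l l′ l∈ l′∈ = Fx l l′ (trans (∈blockSubset⁻ l∈) (sym (∈blockSubset⁻ l′∈)))

  braid-direction : ∀ {H} → H ∈ A n → ∃₂ λ i j → i ≢ j × _≐_ ℝ (⟦_⟧₀ ℝ H) (braid ℝ i j)
  braid-direction {H} H∈A =
    let i , j , i<j , H∥ij = under⊆braid n H H∈A in i , j , <⇒≢ i<j , H∥ij

  module _ (H : Hyperplane ℝ n) {i j : Fin n} (i≢j : i ≢ j)
           (H∥ij : _≐_ ℝ (⟦_⟧₀ ℝ H) (braid ℝ i j)) where

    Localizes-flat⇒sameBlock : Localizes (flat ℝ b) H → b i ≡ b j
    Localizes-flat⇒sameBlock locH with b j ≟ b i
    ... | yes bj≡bi = sym bj≡bi
    ... | no bj≢bi  = contradiction locH (separating-line⇒¬Localizes H H∥ij refl bj≢bi line)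
      where
      line : ∀ t → flat ℝ b (t ∙ χ b (b i))
      line t l l′ bl≡bl′ = cong (λ β → t * (if does (β ≟ b i) then 1# else 0#)) bl≡bl′

    Localizes-V⇒inBlock : ∀ {k} → Localizes (V ℝ (blockSubset k)) H → b i ≡ k
    Localizes-V⇒inBlock {k} locH with b i ≟ k
    ... | yes bi≡k = bi≡k
    ... | no bi≢k  = contradiction locH (separating-line⇒¬Localizes H H∥ij refl (i≢j ∘ sym) line)
      where
      outside : ∀ {l} → l ∈ˢ blockSubset k → l ≢ i
      outside l∈ refl = bi≢k (∈blockSubset⁻ l∈)
      line : ∀ t → V ℝ (blockSubset k) (t ∙ χ id i)
      line t l l′ l∈ l′∈ =
        cong (t *_) (trans (χ-≢ id l (outside l∈)) (sym (χ-≢ id l′ (outside l′∈))))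

    support-in-bᵢ : b i ≡ b j → ∀ {l} → Hyperplane.normal H l ≢ 0# → b l ≡ b i
    support-in-bᵢ bi≡bj wl≢0 with braid-normal-support H H∥ij wl≢0
    ... | inj₁ refl = refl
    ... | inj₂ refl = sym bi≡bj

    block≡bᵢ : b i ≡ b j → block H ≡ b i
    block≡bᵢ bi≡bj = support-in-bᵢ bi≡bj (proj₂ (Hyperplane.nonzero H))

    sameBlock⇒InBlock : b i ≡ b j → InBlock (block H) H
    sameBlock⇒InBlock bi≡bj l wl≢0 = trans (support-in-bᵢ bi≡bj wl≢0) (sym (block≡bᵢ bi≡bj))

  loc-flat⇒InBlock : ∀ {H} → loc ℝ (A n) (flat ℝ b) H → InBlock (block H) H
  loc-flat⇒InBlock {H} (H∈A , locH) =
    let i , j , i≢j , H∥ij = braid-direction H∈A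
    in sameBlock⇒InBlock H i≢j H∥ij (Localizes-flat⇒sameBlock H i≢j H∥ij locH)

  BlockPartᶠ : Fin m → Members ℝ n
  BlockPartᶠ = BlockPart (loc ℝ (A n) (flat ℝ b)) loc-flat⇒InBlock

  loc-V⇒BlockPartᶠ : ∀ {k H} → loc ℝ (A n) (V ℝ (blockSubset k)) H → BlockPartᶠ k H
  loc-V⇒BlockPartᶠ {k} {H} (H∈A , locH) =
    let i , j , i≢j , H∥ij = braid-direction H∈A
        locᶠH = Localizes-antitone {H = H} (flat⊆V k) locH
    in (H∈A , locᶠH) , trans (block≡bᵢ H i≢j H∥ij (Localizes-flat⇒sameBlock H i≢j H∥ij locᶠH))
                             (Localizes-V⇒inBlock H i≢j H∥ij locH)

  BlockPartᶠ⇒loc-V : ∀ {k H} → BlockPartᶠ k H → loc ℝ (A n) (V ℝ (blockSubset k)) H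
  BlockPartᶠ⇒loc-V {H = H} ((H∈A , locᶠH) , refl) = H∈A , lift locᶠH
    where
    k₀ : Fin n
    k₀ = proj₁ (Hyperplane.nonzero H)

    H-local : BlockLocal (block H) (⟦_⟧ ℝ H)
    H-local = InBlock⇒BlockLocal {H = H} (loc-flat⇒InBlock (H∈A , locᶠH))

    flat-const : ∀ x → flat ℝ b (λ _ → x k₀)
    flat-const x _ _ _ = refl

    V-agree : ∀ {x} → V ℝ (blockSubset (block H)) x → Agree (block H) x (λ _ → x k₀)
    V-agree Vx l bl≡bk₀ = Vx l k₀ (∈blockSubset⁺ bl≡bk₀) (∈blockSubset⁺ refl)

    lift : Localizes (flat ℝ b) H → Localizes (V ℝ (blockSubset (block H))) H
    lift (inj₁ F⊆H)   = inj₁ λ x Vx → H-local (Agree-sym (V-agree Vx)) (F⊆H _ (flat-const x))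
    lift (inj₂ F∩H=∅) = inj₂ λ x Vx Hx → F∩H=∅ _ (flat-const x) (H-local (V-agree Vx) Hx)

  𝓛ᶠ : Pre
  𝓛ᶠ = L ℝ (loc ℝ (A n) (flat ℝ b))

  𝓛ᴮ 𝓛ⱽ 𝓛ᴬ : Fin m → Pre
  𝓛ᴮ k = L ℝ (BlockPartᶠ k)
  𝓛ⱽ k = L ℝ (loc ℝ (A n) (V ℝ (blockSubset k)))
  𝓛ᴬ k = L ℝ (mem ℝ (A (blockSize b k)))

  L-flat≅ΠL-V : 𝓛ᶠ ≅ Π m 𝓛ⱽ
  L-flat≅ΠL-V = ≅-trans {𝓛ᶠ} {Π m 𝓛ᴮ} {Π m 𝓛ⱽ} (Π-trans λ _ → L-trans)
                        (L-blocks _ loc-flat⇒InBlock)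
                        (Π-cong {P = 𝓛ᴮ} {Q = 𝓛ⱽ} λ _ → L-cong BlockPartᶠ⇒loc-V loc-V⇒BlockPartᶠ)

  L-V≅L-A : ∀ k → 𝓛ⱽ k ≅ 𝓛ᴬ k
  L-V≅L-A k = subst (λ s → 𝓛ⱽ k ≅ L ℝ (mem ℝ (A s))) (∣blockSubset∣ k) (restrict n (blockSubset k))

lemma7p2 : (ℝ : RealField) (A : (n : ℕ) → Arrangement ℝ n) → Exponential ℝ A →
           (n m : ℕ) (b : Fin n → Fin m) → Surj b →
           L ℝ (loc ℝ (A n) (flat ℝ b)) ≅ Π m (λ i → L ℝ (mem ℝ (A (blockSize b i))))
lemma7p2 ℝ A E n m b _ =
  ≅-trans {𝓛ᶠ} {Π m 𝓛ⱽ} {Π m 𝓛ᴬ} (Π-trans λ _ → L-trans)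
          L-flat≅ΠL-V (Π-cong {P = 𝓛ⱽ} {Q = 𝓛ᴬ} L-V≅L-A)
  where open Localization ℝ A E b
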